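{- Let $(X,1,\curlywedge,\tau)$ be an L-space. Let $U,V\subseteq X$ be closed subsets such that $U$ and $X\setminus V$ are filters and $U\cap V=\emptyset$. Then there exists a clopen filter $W$ of $X$ such that $U\subseteq W$ and $V\subseteq X\setminus W$.
   Context: A filter of a meet semilattice $(X,1,\curlywedge)$ (with order $\preceq$) is a nonempty upward closed subset closed under $\curlywedge$. An HMS-space is a meet semilattice with top $(X,1,\curlywedge)$ equipped with a compact topology $\tau$ such that whenever $x\not\preceq y$ there is a clopen filter $U$ with $x\in U$, $y\notin U$. An L-space is an HMS-space such that $\{1\}$ is clopen and, for all clopen filters $U,V$, the set $U\vee V=\{x\in X\mid \exists y\in U,z\in V,\ y\curlywedge z\preceq x\}$ (the filter generated by $U\cup V$) is clopen. -}

module Defs where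

open import Level using (Level; suc; _⊔_)
open import Data.Product using (Σ; ∃; ∃-syntax; _×_; _,_)
open import Data.List using (List)
open import Data.List.Relation.Unary.Any using (Any)
open import Relation.Nullary using (¬_)
open import Relation.Unary using (Pred; _∈_; _∉_; _⊆_; ∁; _∩_)
open import Data.Empty.Polymorphic using (⊥)
open import Data.Unit.Polymorphic using (⊤)
open import Relation.Binary.PropositionalEquality using (_≡_)

record TopSemilattice (ℓ : Level) : Set (suc ℓ) where
  infixr 7 _⋏_
  field
    Carrier : Set ℓ
    _⋏_     : Carrier → Carrier → Carrier
    top     : Carrier
    ⋏-idem  : ∀ x → x ⋏ x ≡ x
    ⋏-comm  : ∀ x y → x ⋏ y ≡ y ⋏ x
    ⋏-assoc : ∀ x y z → (x ⋏ y) ⋏ z ≡ x ⋏ (y ⋏ z)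
    ⋏-top   : ∀ x → x ⋏ top ≡ x
    IsOpen    : Pred Carrier ℓ → Set ℓ
    open-ext  : ∀ {A B : Pred Carrier ℓ} → A ⊆ B → B ⊆ A → IsOpen A → IsOpen B
    open-∅    : IsOpen (λ _ → ⊥)
    open-X    : IsOpen (λ _ → ⊤)
    open-∩    : ∀ {A B} → IsOpen A → IsOpen B → IsOpen (A ∩ B)
    open-⋃    : (I : Set ℓ) (O : I → Pred Carrier ℓ) → (∀ i → IsOpen (O i)) →
                IsOpen (λ x → ∃[ i ] (x ∈ O i))

  _≼_ : Carrier → Carrier → Set ℓ
  x ≼ y = x ⋏ y ≡ x

  IsClosed : Pred Carrier ℓ → Set ℓ
  IsClosed A = IsOpen (∁ A)

  IsClopen : Pred Carrier ℓ → Set ℓ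
  IsClopen A = IsOpen A × IsClosed A

  IsFilter : Pred Carrier ℓ → Set ℓ
  IsFilter F = (∃[ x ] (x ∈ F))
             × (∀ {x y} → x ∈ F → x ≼ y → y ∈ F)
             × (∀ {x y} → x ∈ F → y ∈ F → (x ⋏ y) ∈ F)

  IsClopenFilter : Pred Carrier ℓ → Set ℓ
  IsClopenFilter A = IsClopen A × IsFilter A

  IsCompact : Set (suc ℓ)
  IsCompact = (I : Set ℓ) (O : I → Pred Carrier ℓ) → (∀ i → IsOpen (O i)) →
              (∀ x → ∃[ i ] (x ∈ O i)) →
              ∃[ is ] (∀ x → Any (λ i → x ∈ O i) is)

  IsHMS : Set (suc ℓ)
  IsHMS = IsCompact
        × (∀ x y → ¬ (x ≼ y) →
             ∃[ W ] (IsClopenFilter W × x ∈ W × y ∉ W))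

  -- U ∨ V : the filter generated by U ∪ V
  _∨F_ : Pred Carrier ℓ → Pred Carrier ℓ → Pred Carrier ℓ
  (A ∨F B) x = ∃[ y ] ∃[ z ] (y ∈ A × z ∈ B × (y ⋏ z) ≼ x)

  IsLSpace : Set (suc ℓ)
  IsLSpace = IsHMS
           × IsClopen (λ x → x ≡ top)
           × (∀ A B → IsClopenFilter A → IsClopenFilter B → IsClopen (A ∨F B))

{-# OPTIONS --safe #-}
-- Each u ∈ U lies outside the closed down-set V, so for every v ∈ V the HMS axiom gives a
-- clopen filter containing u and missing v; compactness of V makes finitely many of them
-- suffice, and their intersection is a clopen filter W_u ∋ u disjoint from V. By compactness
-- of U finitely many W_u cover U, and in an L-space the filter they generate is clopen; it
-- stays inside the filter X ∖ V, which contains every W_u.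
module Submission where

open import Defs
open import Level using (Lift; lift)
open import Algebra.Bundles using (CommutativeSemigroup)
import Algebra.Properties.CommutativeSemigroup as CommutativeSemigroupProperties
open import Data.Bool using (Bool; true; false)
open import Data.Empty using (⊥-elim)
open import Data.Empty.Polymorphic using () renaming (⊥-elim to ⊥ₚ-elim)
open import Data.List using (List; []; _∷_; mapMaybe)
open import Data.List.Relation.Unary.Any using (Any; here; there)
open import Data.List.Relation.Unary.Any.Properties using (gmap; mapMaybe⁺)
open import Data.Maybe using (Maybe; just; nothing; maybe)
import Data.Maybe.Relation.Unary.Any as Maybe
open import Data.Product using (∃-syntax; _×_; _,_; proj₁; proj₂; Σ)
open import Data.Sum using (inj₁; inj₂)
open import Data.Unit.Polymorphic using (⊤; tt)
open import Function using (id)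
open import Relation.Nullary using (yes; no)
open import Relation.Unary using (Pred; _⊆_; ∁; Empty; _∩_; _∪_; _∈_; _∉_; ⋃)
open import Relation.Binary.PropositionalEquality
open import Axiom.ExcludedMiddle using (ExcludedMiddle)

module Properties {ℓ} (S : TopSemilattice ℓ) where
  open TopSemilattice S

  ⋏-commutativeSemigroup : CommutativeSemigroup ℓ ℓ
  ⋏-commutativeSemigroup = record
    { _∙_ = _⋏_
    ; isCommutativeSemigroup = record
      { isSemigroup = record
        { isMagma = record { isEquivalence = isEquivalence ; ∙-cong = cong₂ _⋏_ }
        ; assoc   = ⋏-assoc
        }
      ; comm = ⋏-comm
      }
    }

  open CommutativeSemigroupProperties ⋏-commutativeSemigroup using (interchange)

  ≼-refl : ∀ {x} → x ≼ x
  ≼-refl {x} = ⋏-idem x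

  ≼-trans : ∀ {x y z} → x ≼ y → y ≼ z → x ≼ z
  ≼-trans {x} {y} {z} x≼y y≼z = begin
    x ⋏ z        ≡⟨ cong (_⋏ z) (sym x≼y) ⟩
    (x ⋏ y) ⋏ z  ≡⟨ ⋏-assoc x y z ⟩
    x ⋏ (y ⋏ z)  ≡⟨ cong (x ⋏_) y≼z ⟩
    x ⋏ y        ≡⟨ x≼y ⟩
    x            ∎
    where open ≡-Reasoning

  ≼-top : ∀ {x} → x ≼ top
  ≼-top {x} = ⋏-top x

  ⋏-mono-≼ : ∀ {a b c d} → a ≼ b → c ≼ d → (a ⋏ c) ≼ (b ⋏ d)
  ⋏-mono-≼ {a} {b} {c} {d} a≼b c≼d = trans (interchange a c b d) (cong₂ _⋏_ a≼b c≼d)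

  x⋏top≼x : ∀ {x} → (x ⋏ top) ≼ x
  x⋏top≼x {x} = subst (_≼ x) (sym (⋏-top x)) ≼-refl

  top⋏x≼x : ∀ {x} → (top ⋏ x) ≼ x
  top⋏x≼x {x} = subst (_≼ x) (⋏-comm x top) x⋏top≼x

  IsUpSet : Pred Carrier ℓ → Set ℓ
  IsUpSet F = ∀ {x y} → x ∈ F → x ≼ y → y ∈ F

  Whole : Pred Carrier ℓ
  Whole _ = ⊤

  Top : Pred Carrier ℓ
  Top x = x ≡ top

  top∈filter : ∀ {F} → IsFilter F → top ∈ F
  top∈filter ((_ , x∈F) , up , _) = up x∈F ≼-top

  Whole-filter : IsFilter Whole
  Whole-filter = (top , tt) , (λ _ _ → tt) , (λ _ _ → tt)

  Top-filter : IsFilter Top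
  Top-filter = (top , refl) , up , λ { refl refl → ⋏-idem top }
    where
      up : IsUpSet Top
      up {y = y} refl top≼y = trans (sym (⋏-top y)) (trans (⋏-comm y top) top≼y)

  ∩-filter : ∀ {A B} → IsFilter A → IsFilter B → IsFilter (A ∩ B)
  ∩-filter fA@(_ , upA , ⋏A) fB@(_ , upB , ⋏B) =
    (top , top∈filter fA , top∈filter fB) ,
    (λ (a , b) x≼y → upA a x≼y , upB b x≼y) ,
    (λ (a , b) (a′ , b′) → ⋏A a a′ , ⋏B b b′)

  ∨F-filter : ∀ {A B} → IsFilter A → IsFilter B → IsFilter (A ∨F B)
  ∨F-filter {A} {B} fA@(_ , _ , ⋏A) fB@(_ , _ , ⋏B) =
    (top , top , top , top∈filter fA , top∈filter fB , ≼-top) ,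
    (λ (y , z , a , b , y⋏z≼x) x≼x′ → y , z , a , b , ≼-trans y⋏z≼x x≼x′) ,
    ⋏-closed
    where
      ⋏-closed : ∀ {x x′} → x ∈ A ∨F B → x′ ∈ A ∨F B → (x ⋏ x′) ∈ A ∨F B
      ⋏-closed {x} {x′} (y , z , a , b , y⋏z≼x) (y′ , z′ , a′ , b′ , y′⋏z′≼x′) =
        y ⋏ y′ , z ⋏ z′ , ⋏A a a′ , ⋏B b b′ ,
        subst (_≼ (x ⋏ x′)) (interchange y z y′ z′) (⋏-mono-≼ y⋏z≼x y′⋏z′≼x′)

  ⊆-∨Fˡ : ∀ {A B} → IsFilter B → A ⊆ A ∨F B
  ⊆-∨Fˡ fB {x} x∈A = x , top , x∈A , top∈filter fB , x⋏top≼x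

  ⊆-∨Fʳ : ∀ {A B} → IsFilter A → B ⊆ A ∨F B
  ⊆-∨Fʳ fA {x} x∈B = top , x , top∈filter fA , x∈B , top⋏x≼x

  ∨F-least : ∀ {A B F} → IsFilter F → A ⊆ F → B ⊆ F → A ∨F B ⊆ F
  ∨F-least (_ , up , ⋏F) A⊆F B⊆F (_ , _ , a , b , y⋏z≼x) = up (⋏F (A⊆F a) (B⊆F b)) y⋏z≼x

  open-∪ : ∀ {A B} → IsOpen A → IsOpen B → IsOpen (A ∪ B)
  open-∪ {A} {B} oA oB = open-ext from to (open-⋃ (Lift ℓ Bool) O O-open)
    where
      O : Lift ℓ Bool → Pred Carrier ℓ
      O (lift true)  = A
      O (lift false) = B
      O-open : ∀ i → IsOpen (O i)
      O-open (lift true)  = oA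
      O-open (lift false) = oB
      from : ⋃ (Lift ℓ Bool) O ⊆ A ∪ B
      from (lift true  , x∈A) = inj₁ x∈A
      from (lift false , x∈B) = inj₂ x∈B
      to : A ∪ B ⊆ ⋃ (Lift ℓ Bool) O
      to (inj₁ x∈A) = lift true  , x∈A
      to (inj₂ x∈B) = lift false , x∈B

  closed-∩ : ExcludedMiddle ℓ → ∀ {A B} → IsClosed A → IsClosed B → IsClosed (A ∩ B)
  closed-∩ em {A} {B} cA cB = open-ext from to (open-∪ cA cB)
    where
      from : ∁ A ∪ ∁ B ⊆ ∁ (A ∩ B)
      from (inj₁ x∉A) (x∈A , _) = x∉A x∈A
      from (inj₂ x∉B) (_ , x∈B) = x∉B x∈B
      to : ∁ (A ∩ B) ⊆ ∁ A ∪ ∁ B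
      to {x} x∉A∩B with em {x ∈ A}
      ... | yes x∈A = inj₂ λ x∈B → x∉A∩B (x∈A , x∈B)
      ... | no  x∉A = inj₁ x∉A

  Whole-clopenFilter : IsClopenFilter Whole
  Whole-clopenFilter = (open-X , open-ext ⊥ₚ-elim (λ x∉Whole → ⊥-elim (x∉Whole tt)) open-∅) , Whole-filter

  -- The cover of the whole space is completed by the open set X ∖ K, whose index
  -- (nothing) is then discarded.
  closed-compact : ExcludedMiddle ℓ → IsCompact → ∀ {K} → IsClosed K →
                   {I : Set ℓ} (O : I → Pred Carrier ℓ) → (∀ i → IsOpen (O i)) → K ⊆ ⋃ I O →
                   ∃[ is ] (∀ {x} → x ∈ K → Any (λ i → x ∈ O i) is)
  closed-compact em compact {K} K-closed {I} O O-open K⊆⋃O =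
    let js , js-cover = compact (Maybe I) O′ O′-open cover
    in  mapMaybe id js , λ x∈K → mapMaybe⁺ id js (gmap (drop-nothing x∈K) (js-cover _))
    where
      O′ : Maybe I → Pred Carrier ℓ
      O′ = maybe O (∁ K)
      O′-open : ∀ j → IsOpen (O′ j)
      O′-open (just i) = O-open i
      O′-open nothing  = K-closed
      cover : ∀ x → ∃[ j ] (x ∈ O′ j)
      cover x with em {x ∈ K}
      ... | yes x∈K = let i , x∈Oi = K⊆⋃O x∈K in just i , x∈Oi
      ... | no  x∉K = nothing , x∉K
      drop-nothing : ∀ {x} → x ∈ K → ∀ {j} → x ∈ O′ j → Maybe.Any (λ i → x ∈ O i) j
      drop-nothing _   {just i} x∈Oi = Maybe.just x∈Oi
      drop-nothing x∈K {nothing} x∉K = ⊥-elim (x∉K x∈K)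

  module _ {I : Set ℓ} (G : I → Pred Carrier ℓ) where

    ⋀ : List I → Pred Carrier ℓ
    ⋀ []       = Whole
    ⋀ (i ∷ is) = G i ∩ ⋀ is

    ⋁ : List I → Pred Carrier ℓ
    ⋁ []       = Top
    ⋁ (i ∷ is) = G i ∨F ⋁ is

    ∈-⋀ : ∀ {x} is → (∀ i → x ∈ G i) → x ∈ ⋀ is
    ∈-⋀ []       x∈G = tt
    ∈-⋀ (i ∷ is) x∈G = x∈G i , ∈-⋀ is x∈G

    ∉-⋀ : ∀ {x} is → Any (λ i → x ∉ G i) is → x ∉ ⋀ is
    ∉-⋀ (i ∷ is) (here x∉Gi)  (x∈Gi , _)   = x∉Gi x∈Gi
    ∉-⋀ (i ∷ is) (there x∉Gj) (_ , x∈⋀is) = ∉-⋀ is x∉Gj x∈⋀is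

    ⋀-clopenFilter : ExcludedMiddle ℓ → (∀ i → IsClopenFilter (G i)) → ∀ is → IsClopenFilter (⋀ is)
    ⋀-clopenFilter em G-cf []       = Whole-clopenFilter
    ⋀-clopenFilter em G-cf (i ∷ is) with G-cf i | ⋀-clopenFilter em G-cf is
    ... | (oG , cG) , fG | (o⋀ , c⋀) , f⋀ = (open-∩ oG o⋀ , closed-∩ em cG c⋀) , ∩-filter fG f⋀

    ⋁-filter : (∀ i → IsFilter (G i)) → ∀ is → IsFilter (⋁ is)
    ⋁-filter G-filter []       = Top-filter
    ⋁-filter G-filter (i ∷ is) = ∨F-filter (G-filter i) (⋁-filter G-filter is)

    ∈-⋁ : (∀ i → IsFilter (G i)) → ∀ {x} is → Any (λ i → x ∈ G i) is → x ∈ ⋁ is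
    ∈-⋁ G-filter (i ∷ is) (here x∈Gi)  = ⊆-∨Fˡ (⋁-filter G-filter is) x∈Gi
    ∈-⋁ G-filter (i ∷ is) (there x∈Gj) = ⊆-∨Fʳ (G-filter i) (∈-⋁ G-filter is x∈Gj)

    ⋁-least : ∀ {F} → IsFilter F → (∀ i → G i ⊆ F) → ∀ is → ⋁ is ⊆ F
    ⋁-least fF G⊆F []       refl = top∈filter fF
    ⋁-least fF G⊆F (i ∷ is)      = ∨F-least fF (G⊆F i) (⋁-least fF G⊆F is)

    ⋁-clopenFilter : IsLSpace → (∀ i → IsClopenFilter (G i)) → ∀ is → IsClopenFilter (⋁ is)
    ⋁-clopenFilter (_ , Top-clopen , _)   G-cf []       = Top-clopen , Top-filter
    ⋁-clopenFilter L@(_ , _ , ∨F-clopen) G-cf (i ∷ is) =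
      ∨F-clopen (G i) (⋁ is) (G-cf i) (⋁-clopenFilter L G-cf is) ,
      ⋁-filter (λ j → proj₂ (G-cf j)) (i ∷ is)

  clopenFilter-∋-⊆∁ : ExcludedMiddle ℓ → IsHMS → ∀ {V u} → IsClosed V → IsUpSet (∁ V) → u ∉ V →
                      ∃[ W ] (IsClopenFilter W × u ∈ W × W ⊆ ∁ V)
  clopenFilter-∋-⊆∁ em (compact , separate) {V} {u} V-closed ∁V-up u∉V =
    let vs , vs-cover = closed-compact em compact V-closed (λ v → ∁ (G v))
                                       (λ v → proj₂ (proj₁ (G-cf v))) V⊆⋃∁G
    in  ⋀ G vs , ⋀-clopenFilter G em G-cf vs , ∈-⋀ G vs u∈G ,
        λ x∈⋀ x∈V → ∉-⋀ G vs (vs-cover x∈V) x∈⋀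
    where
      Vₚ : Set ℓ
      Vₚ = Σ Carrier (_∈ V)
      separation : ((v , _) : Vₚ) → ∃[ W ] (IsClopenFilter W × u ∈ W × v ∉ W)
      separation (v , v∈V) = separate u v (λ u≼v → ∁V-up u∉V u≼v v∈V)
      G : Vₚ → Pred Carrier ℓ
      G v = proj₁ (separation v)
      G-cf : ∀ v → IsClopenFilter (G v)
      G-cf v = proj₁ (proj₂ (separation v))
      u∈G : ∀ v → u ∈ G v
      u∈G v = proj₁ (proj₂ (proj₂ (separation v)))
      V⊆⋃∁G : V ⊆ ⋃ Vₚ (λ v → ∁ (G v))
      V⊆⋃∁G {v} v∈V = (v , v∈V) , proj₂ (proj₂ (proj₂ (separation (v , v∈V))))

  clopenFilter-⊇-⊆ : ExcludedMiddle ℓ → IsLSpace → ∀ {U F} → IsClosed U → IsFilter F →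
                     (∀ {u} → u ∈ U → ∃[ W ] (IsClopenFilter W × u ∈ W × W ⊆ F)) →
                     ∃[ W ] (IsClopenFilter W × U ⊆ W × W ⊆ F)
  clopenFilter-⊇-⊆ em L@((compact , _) , _) {U} {F} U-closed F-filter around =
    let us , us-cover = closed-compact em compact U-closed G (λ u → proj₁ (proj₁ (G-cf u))) U⊆⋃G
    in  ⋁ G us , ⋁-clopenFilter G L G-cf us ,
        (λ x∈U → ∈-⋁ G (λ u → proj₂ (G-cf u)) us (us-cover x∈U)) ,
        ⋁-least G F-filter G⊆F us
    where
      Uₚ : Set ℓ
      Uₚ = Σ Carrier (_∈ U)
      G : Uₚ → Pred Carrier ℓ
      G (_ , u∈U) = proj₁ (around u∈U)
      G-cf : ∀ u → IsClopenFilter (G u)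
      G-cf (_ , u∈U) = proj₁ (proj₂ (around u∈U))
      G⊆F : ∀ u → G u ⊆ F
      G⊆F (_ , u∈U) = proj₂ (proj₂ (proj₂ (around u∈U)))
      U⊆⋃G : U ⊆ ⋃ Uₚ G
      U⊆⋃G {u} u∈U = (u , u∈U) , proj₁ (proj₂ (proj₂ (around u∈U)))

lemma3p11 : ∀ {ℓ} → ExcludedMiddle ℓ → (S : TopSemilattice ℓ) →
    let open TopSemilattice S in
    IsLSpace → (U V : Pred Carrier ℓ) →
    IsClosed U → IsClosed V → IsFilter U → IsFilter (∁ V) → Empty (U ∩ V) →
    ∃[ W ] (IsClopenFilter W × U ⊆ W × V ⊆ ∁ W)
lemma3p11 em S L@(hms , _) U V U-closed V-closed _ ∁V-filter@(_ , ∁V-up , _) U∩V=∅ =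
  let W , W-cf , U⊆W , W⊆∁V = clopenFilter-⊇-⊆ em L U-closed ∁V-filter around
  in  W , W-cf , U⊆W , λ x∈V x∈W → W⊆∁V x∈W x∈V
  where
    open TopSemilattice S
    open Properties S
    around : ∀ {u} → u ∈ U → ∃[ W ] (IsClopenFilter W × u ∈ W × W ⊆ ∁ V)
    around {u} u∈U = clopenFilter-∋-⊆∁ em hms V-closed ∁V-up (λ u∈V → U∩V=∅ u (u∈U , u∈V))
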